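{- Let $\mathcal L=\mathcal L_M$ with $M\subseteq\{\Diamond,\forall\}$ and let $\Lambda$ be an admissible intuitionistic temporal logic over $\mathcal L$. Let $P$ be the set of prime $\mathcal L$-types, and for $\Phi,\Psi\in P$ let $\Phi\preccurlyeq_c\Psi$ iff $\Phi^+\subseteq\Psi^+$ and $\Psi^-\subseteq\Phi^-$. Then $\preccurlyeq_c$ is a partial order on $P$, and for every $\Phi\in P$ and every $\varphi\to\psi\in\Phi^-$ there is $\Psi\in P$ with $\Phi\preccurlyeq_c\Psi$, $\varphi\in\Psi^+$ and $\psi\in\Psi^-$. (That is, the canonical model of $\Lambda$ is a labelled frame.)
   Context: $\mathcal L_M$ is the propositional language with $\bot$, variables, $\wedge,\vee,\to$, ${\circ}$ and the modalities in $M$. ${\sf ITL}^0_M$ is the logic with all substitution instances of the intuitionistic propositional axioms and $\neg{\circ}\bot$, ${\circ}\varphi\wedge{\circ}\psi\to{\circ}(\varphi\wedge\psi)$, ${\circ}(\varphi\vee\psi)\to{\circ}\varphi\vee{\circ}\psi$, ${\circ}(\varphi\to\psi)\to({\circ}\varphi\to{\circ}\psi)$, closed under modus ponens and from $\varphi$ infer ${\circ}\varphi$; if $\Diamond\in M$ additionally the axiom $\varphi\vee{\circ}\Diamond\varphi\to\Diamond\varphi$ and rules from $\varphi\to\psi$ infer $\Diamond\varphi\to\Diamond\psi$, from ${\circ}\varphi\to\varphi$ infer $\Diamond\varphi\to\varphi$; if $\forall\in M$ additionally $\forall\varphi\vee\neg\forall\varphi$, $\forall(\varphi\to\psi)\to(\forall\varphi\to\forall\psi)$,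 $\forall(\varphi\vee\forall\psi)\to\forall\varphi\vee\forall\psi$, $\forall\varphi\to\varphi$, $\forall\varphi\to\forall\forall\varphi$, $\forall\varphi\leftrightarrow{\circ}\forall\varphi$ and the rule from $\varphi$ infer $\forall\varphi$. An admissible intuitionistic temporal logic over $\mathcal L_M$ is a set $\Lambda$ of $\mathcal L_M$-formulas containing all substitution instances of the axioms of ${\sf ITL}^0_M$ and closed under its rules. $\Gamma\vdash\Delta$ means there are finite $\Gamma'\subseteq\Gamma$, $\Delta'\subseteq\Delta$ with $\bigwedge\Gamma'\to\bigvee\Delta'\in\Lambda$ ($\bigwedge\varnothing=\top$, $\bigvee\varnothing=\bot$). A prime $\mathcal L$-type is a pair $(\Phi^+,\Phi^-)$ of sets of $\mathcal L$-formulas with $\Phi^+\cup\Phi^-=\mathcal L$ and $\Phi^+\not\vdash\Phi^-$. -}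

module Defs where

open import Data.Bool using (Bool; true; false; T)
open import Data.Nat using (ℕ)
open import Data.List using (List; []; _∷_)
open import Data.List.Relation.Unary.All using (All)
open import Data.Product using (Σ; _×_; _,_; ∃)
open import Data.Sum using (_⊎_)
open import Relation.Nullary using (¬_)
open import Relation.Unary using (Pred; _⊆_; _≐_)
open import Level using (0ℓ)

-- The set of modalities M ⊆ {◇, ∀} is encoded by two booleans:
-- d = true iff ◇ ∈ M, a = true iff ∀ ∈ M.

record Mods : Set where
  constructor mods
  field
    hasDia : Bool
    hasAll : Bool
open Mods public

data Form (M : Mods) : Set where
  var   : ℕ → Form M
  ⊥'    : Form M
  _∧'_  : Form M → Form M → Form M
  _∨'_  : Form M → Form M → Form M
  _⇒_   : Form M → Form M → Form M
  ○_    : Form M → Form M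
  ◇⟨_⟩_ : T (hasDia M) → Form M → Form M
  ∀⟨_⟩_ : T (hasAll M) → Form M → Form M

infixr 6 _∧'_
infixr 5 _∨'_
infixr 4 _⇒_

module _ {M : Mods} where
  ¬'_ : Form M → Form M
  ¬' φ = φ ⇒ ⊥'

  ⊤' : Form M
  ⊤' = ⊥' ⇒ ⊥'

  _⇔_ : Form M → Form M → Form M
  φ ⇔ ψ = (φ ⇒ ψ) ∧' (ψ ⇒ φ)

  ⋀ : List (Form M) → Form M
  ⋀ []           = ⊤'
  ⋀ (φ ∷ [])     = φ
  ⋀ (φ ∷ ψ ∷ xs) = φ ∧' ⋀ (ψ ∷ xs)

  ⋁ : List (Form M) → Form M
  ⋁ []           = ⊥'
  ⋁ (φ ∷ [])     = φ
  ⋁ (φ ∷ ψ ∷ xs) = φ ∨' ⋁ (ψ ∷ xs)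

-- The intuitionistic propositional axioms are given by
-- a standard Hilbert-style axiomatisation (schemes, so all substitution
-- instances are included).

record IsAdmissible (M : Mods) (Λ : Pred (Form M) 0ℓ) : Set where
  field
    ax-K    : ∀ φ ψ → Λ (φ ⇒ (ψ ⇒ φ))
    ax-S    : ∀ φ ψ χ → Λ ((φ ⇒ (ψ ⇒ χ)) ⇒ ((φ ⇒ ψ) ⇒ (φ ⇒ χ)))
    ax-∧E₁  : ∀ φ ψ → Λ (φ ∧' ψ ⇒ φ)
    ax-∧E₂  : ∀ φ ψ → Λ (φ ∧' ψ ⇒ ψ)
    ax-∧I   : ∀ φ ψ → Λ (φ ⇒ (ψ ⇒ φ ∧' ψ))
    ax-∨I₁  : ∀ φ ψ → Λ (φ ⇒ φ ∨' ψ)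
    ax-∨I₂  : ∀ φ ψ → Λ (ψ ⇒ φ ∨' ψ)
    ax-∨E   : ∀ φ ψ χ → Λ ((φ ⇒ χ) ⇒ ((ψ ⇒ χ) ⇒ (φ ∨' ψ ⇒ χ)))
    ax-⊥E   : ∀ φ → Λ (⊥' ⇒ φ)
    ax-○⊥   : Λ (¬' (○ ⊥'))
    ax-○∧   : ∀ φ ψ → Λ ((○ φ) ∧' (○ ψ) ⇒ ○ (φ ∧' ψ))
    ax-○∨   : ∀ φ ψ → Λ (○ (φ ∨' ψ) ⇒ (○ φ) ∨' (○ ψ))
    ax-○⇒   : ∀ φ ψ → Λ (○ (φ ⇒ ψ) ⇒ ((○ φ) ⇒ (○ ψ)))
    mp      : ∀ {φ ψ} → Λ (φ ⇒ ψ) → Λ φ → Λ ψ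
    nec-○   : ∀ {φ} → Λ φ → Λ (○ φ)
    ax-◇    : ∀ (d : T (hasDia M)) φ →
                Λ (φ ∨' (○ (◇⟨ d ⟩ φ)) ⇒ ◇⟨ d ⟩ φ)
    mono-◇  : ∀ (d : T (hasDia M)) {φ ψ} →
                Λ (φ ⇒ ψ) → Λ (◇⟨ d ⟩ φ ⇒ ◇⟨ d ⟩ ψ)
    ind-◇   : ∀ (d : T (hasDia M)) {φ} →
                Λ ((○ φ) ⇒ φ) → Λ (◇⟨ d ⟩ φ ⇒ φ)
    ax-∀lem : ∀ (a : T (hasAll M)) φ → Λ ((∀⟨ a ⟩ φ) ∨' ¬' (∀⟨ a ⟩ φ))
    ax-∀K   : ∀ (a : T (hasAll M)) φ ψ →
                Λ (∀⟨ a ⟩ (φ ⇒ ψ) ⇒ ((∀⟨ a ⟩ φ) ⇒ (∀⟨ a ⟩ ψ)))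
    ax-∀∨   : ∀ (a : T (hasAll M)) φ ψ →
                Λ (∀⟨ a ⟩ (φ ∨' (∀⟨ a ⟩ ψ)) ⇒ (∀⟨ a ⟩ φ) ∨' (∀⟨ a ⟩ ψ))
    ax-∀T   : ∀ (a : T (hasAll M)) φ → Λ (∀⟨ a ⟩ φ ⇒ φ)
    ax-∀4   : ∀ (a : T (hasAll M)) φ → Λ (∀⟨ a ⟩ φ ⇒ ∀⟨ a ⟩ (∀⟨ a ⟩ φ))
    ax-∀○   : ∀ (a : T (hasAll M)) φ → Λ ((∀⟨ a ⟩ φ) ⇔ (○ (∀⟨ a ⟩ φ)))
    nec-∀   : ∀ (a : T (hasAll M)) {φ} → Λ φ → Λ (∀⟨ a ⟩ φ)

module _ {M : Mods} (Λ : Pred (Form M) 0ℓ) where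

  _⊢_ : Pred (Form M) 0ℓ → Pred (Form M) 0ℓ → Set
  Γ ⊢ Δ = Σ (List (Form M)) λ Γ' → Σ (List (Form M)) λ Δ' →
            All Γ Γ' × All Δ Δ' × Λ (⋀ Γ' ⇒ ⋁ Δ')

  record PrimeType : Set₁ where
    field
      pos      : Pred (Form M) 0ℓ
      neg      : Pred (Form M) 0ℓ
      covers   : ∀ φ → pos φ ⊎ neg φ
      unproves : ¬ (pos ⊢ neg)
  open PrimeType public

  _≈T_ : PrimeType → PrimeType → Set
  Φ ≈T Ψ = (pos Φ ≐ pos Ψ) × (neg Φ ≐ neg Ψ)

  _≼c_ : PrimeType → PrimeType → Set
  Φ ≼c Ψ = (pos Φ ⊆ pos Ψ) × (neg Ψ ⊆ neg Φ)

-- ≼c is the product of ⊆ on Φ⁺ and ⊇ on Φ⁻ pulled back along Φ ↦ (Φ⁺, Φ⁻),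
-- hence a partial order. If φ ⇒ ψ ∈ Φ⁻ then Φ⁺ ∪ {φ} ⊬ {ψ}, since otherwise the
-- deduction theorem gives Φ⁺ ⊢ φ ⇒ ψ. A Lindenbaum construction extends this
-- pair to a prime type Ψ: along an enumeration of 𝓛 each formula is put on one
-- side, excluded middle choosing the side and cut keeping the pair unprovable.
-- Then Φ⁺ ⊆ Ψ⁺ already forces Ψ⁻ ⊆ Φ⁻, because the two halves of a prime type
-- are disjoint while those of Φ cover 𝓛.
module Submission where

open import Defs
open import Level using (0ℓ)
open import Axiom.ExcludedMiddle using (ExcludedMiddle)
open import Data.Bool using (Bool; true; false; T)
open import Data.Unit using (tt)
open import Data.Empty using (⊥; ⊥-elim)
open import Data.Nat using (ℕ; zero; suc; _≤_; _≤′_; ≤′-refl; ≤′-step; _⊔_)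
open import Data.Nat.Properties using (≤⇒≤′; m≤m⊔n; m≤n⊔m)
open import Data.Product using (Σ; ∃; _×_; _,_; proj₁; proj₂)
open import Data.Product.Relation.Binary.Pointwise.NonDependent using (×-isPartialOrder)
open import Data.Sum using (_⊎_; inj₁; inj₂) renaming (map to ⊎-map)
open import Data.List using (List; []; _∷_; _++_; map; concat; cartesianProductWith)
open import Data.List.Relation.Unary.All using (All; []; _∷_) renaming (map to All-map; lookup to All-lookup)
open import Data.List.Relation.Unary.All.Properties using (++⁺)
open import Data.List.Relation.Unary.Any using (here; there)
open import Data.List.Membership.Propositional using (_∈_)
open import Data.List.Membership.Propositional.Properties using (∈-map⁺; ∈-concat⁺′; ∈-cartesianProductWith⁺)
import Data.List.Relation.Binary.Subset.Propositional as List
open import Data.List.Relation.Binary.Subset.Propositional.Properties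
  using (∷⁺ʳ; ∈-∷⁺ʳ; xs⊆x∷xs; xs⊆xs++ys; xs⊆ys++xs) renaming (⊆-refl to ⊆ˡ-refl; ⊆-trans to ⊆ˡ-trans)
open import Relation.Nullary using (¬_; Dec; yes; no)
open import Relation.Unary using (Pred; _⊆_; _∪_; ｛_｝)
open import Relation.Unary.Relation.Binary.Subset using (⊆-isPartialOrder)
open import Relation.Binary.Core using (Rel)
open import Relation.Binary.Definitions using (Reflexive; Transitive)
open import Relation.Binary.Structures using (IsPartialOrder)
import Relation.Binary.Construct.On as On
import Relation.Binary.Construct.Flip.EqAndOrd as Flip
open import Relation.Binary.PropositionalEquality using (refl; sym)

step-increasing⇒monotone : ∀ {a ℓ} {A : Set a} (_≲_ : Rel A ℓ) →
  Reflexive _≲_ → Transitive _≲_ → (f : ℕ → A) → (∀ n → f n ≲ f (suc n)) →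
  ∀ {m n} → m ≤ n → f m ≲ f n
step-increasing⇒monotone _≲_ refl′ trans′ f step m≤n = go (≤⇒≤′ m≤n)
  where
    go : ∀ {m n} → m ≤′ n → f m ≲ f n
    go ≤′-refl        = refl′
    go (≤′-step m≤′n) = trans′ (go m≤′n) (step _)

All∃⇒∃All : ∀ {a ℓ} {A : Set a} {P : ℕ → Pred A ℓ} →
  (∀ {m n} → m ≤ n → P m ⊆ P n) →
  ∀ {xs} → All (λ x → ∃ λ n → P n x) xs → ∃ λ n → All (P n) xs
All∃⇒∃All mono []             = zero , []
All∃⇒∃All mono ((n , p) ∷ ps) with All∃⇒∃All mono ps
... | m , qs = n ⊔ m , mono (m≤m⊔n n m) p ∷ All-map (mono (m≤n⊔m n m)) qs

All-∪｛｝-split : ∀ {a ℓ} {A : Set a} {P : Pred A ℓ} {χ} {xs} → All (P ∪ ｛ χ ｝) xs →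
  Σ (List A) λ ys → All P ys × xs List.⊆ χ ∷ ys
All-∪｛｝-split [] = [] , [] , λ ()
All-∪｛｝-split {χ = χ} {x ∷ _} (inj₁ p ∷ ps) with All-∪｛｝-split ps
... | ys , qs , xs⊆ = x ∷ ys , p ∷ qs , ∈-∷⁺ʳ (there (here refl)) (⊆ˡ-trans xs⊆ (∷⁺ʳ χ (xs⊆x∷xs ys x)))
All-∪｛｝-split (inj₂ refl ∷ ps) with All-∪｛｝-split ps
... | ys , qs , xs⊆ = ys , qs , ∈-∷⁺ʳ (here refl) xs⊆

module Enumeration (M : Mods) where

  witnesses : (b : Bool) → List (T b)
  witnesses true  = tt ∷ []
  witnesses false = []

  ∈-witnesses : ∀ {b} (t : T b) → t ∈ witnesses b
  ∈-witnesses {true} tt = here refl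

  layer : List (Form M) → List (List (Form M))
  layer fs = fs
           ∷ cartesianProductWith _∧'_ fs fs
           ∷ cartesianProductWith _∨'_ fs fs
           ∷ cartesianProductWith _⇒_ fs fs
           ∷ map ○_ fs
           ∷ cartesianProductWith ◇⟨_⟩_ (witnesses (hasDia M)) fs
           ∷ cartesianProductWith ∀⟨_⟩_ (witnesses (hasAll M)) fs
           ∷ []

  formulas : ℕ → List (Form M)
  formulas zero    = ⊥' ∷ []
  formulas (suc n) = var n ∷ concat (layer (formulas n))

  ∈-formulas-suc : ∀ {n φ fs} → φ ∈ fs → fs ∈ layer (formulas n) → φ ∈ formulas (suc n)
  ∈-formulas-suc φ∈fs fs∈layer = there (∈-concat⁺′ φ∈fs fs∈layer)

  formulas-mono : ∀ {m n} → m ≤ n → formulas m List.⊆ formulas n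
  formulas-mono = step-increasing⇒monotone List._⊆_ ⊆ˡ-refl ⊆ˡ-trans formulas
    (λ n φ∈ → ∈-formulas-suc φ∈ (here refl))

  private
    Enumerated : Form M → Set
    Enumerated φ = ∃ λ n → φ ∈ formulas n

    binary : (c : Form M → Form M → Form M) →
      (∀ {fs} → cartesianProductWith c fs fs ∈ layer fs) →
      ∀ {φ ψ} → Enumerated φ → Enumerated ψ → Enumerated (c φ ψ)
    binary c c∈layer (m , φ∈) (n , ψ∈) = suc (m ⊔ n) , ∈-formulas-suc
      (∈-cartesianProductWith⁺ c (formulas-mono (m≤m⊔n m n) φ∈) (formulas-mono (m≤n⊔m m n) ψ∈))
      c∈layer

  formulas-complete : ∀ φ → ∃ λ n → φ ∈ formulas n
  formulas-complete (var k)   = suc k , here refl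
  formulas-complete ⊥'        = zero , here refl
  formulas-complete (φ ∧' ψ)  = binary _∧'_ (there (here refl)) (formulas-complete φ) (formulas-complete ψ)
  formulas-complete (φ ∨' ψ)  = binary _∨'_ (there (there (here refl))) (formulas-complete φ) (formulas-complete ψ)
  formulas-complete (φ ⇒ ψ)   = binary _⇒_ (there (there (there (here refl)))) (formulas-complete φ) (formulas-complete ψ)
  formulas-complete (○ φ) with formulas-complete φ
  ... | n , φ∈ = suc n , ∈-formulas-suc (∈-map⁺ ○_ φ∈) (there (there (there (there (here refl)))))
  formulas-complete (◇⟨ d ⟩ φ) with formulas-complete φ
  ... | n , φ∈ = suc n , ∈-formulas-suc (∈-cartesianProductWith⁺ ◇⟨_⟩_ (∈-witnesses d) φ∈)
                           (there (there (there (there (there (here refl))))))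
  formulas-complete (∀⟨ a ⟩ φ) with formulas-complete φ
  ... | n , φ∈ = suc n , ∈-formulas-suc (∈-cartesianProductWith⁺ ∀⟨_⟩_ (∈-witnesses a) φ∈)
                           (there (there (there (there (there (there (here refl)))))))

module HilbertCalculus {M : Mods} {Λ : Pred (Form M) 0ℓ} (adm : IsAdmissible M Λ) where
  open IsAdmissible adm

  ⇒-refl : ∀ φ → Λ (φ ⇒ φ)
  ⇒-refl φ = mp (mp (ax-S φ (φ ⇒ φ) φ) (ax-K φ (φ ⇒ φ))) (ax-K φ φ)

  -- Hypotheses are discharged head first, so (φ ∷ Γ) ▷ ψ is definitionally
  -- Γ ▷ (φ ⇒ ψ): the deduction theorem holds by construction.
  _⇛_ : List (Form M) → Form M → Form M
  []      ⇛ φ = φ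
  (γ ∷ Γ) ⇛ φ = Γ ⇛ (γ ⇒ φ)

  _▷_ : List (Form M) → Form M → Set
  Γ ▷ φ = Λ (Γ ⇛ φ)

  ▷-theorem : ∀ Γ {φ} → Λ φ → Γ ▷ φ
  ▷-theorem []      ⊢φ = ⊢φ
  ▷-theorem (γ ∷ Γ) ⊢φ = ▷-theorem Γ (mp (ax-K _ γ) ⊢φ)

  ▷-mp : ∀ Γ {φ ψ} → Γ ▷ (φ ⇒ ψ) → Γ ▷ φ → Γ ▷ ψ
  ▷-mp []      ▷φ⇒ψ ▷φ = mp ▷φ⇒ψ ▷φ
  ▷-mp (γ ∷ Γ) ▷φ⇒ψ ▷φ = ▷-mp Γ (▷-mp Γ (▷-theorem Γ (ax-S γ _ _)) ▷φ⇒ψ) ▷φ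

  ▷-hyp : ∀ Γ {φ} → φ ∈ Γ → Γ ▷ φ
  ▷-hyp (γ ∷ Γ) (here refl) = ▷-theorem Γ (⇒-refl γ)
  ▷-hyp (γ ∷ Γ) (there φ∈Γ) = ▷-mp Γ (▷-theorem Γ (ax-K _ γ)) (▷-hyp Γ φ∈Γ)

  ▷-subst : ∀ Δ Γ {φ} → Δ ▷ φ → (∀ {δ} → δ ∈ Δ → Γ ▷ δ) → Γ ▷ φ
  ▷-subst []      Γ Δ▷φ Γ▷Δ = ▷-theorem Γ Δ▷φ
  ▷-subst (δ ∷ Δ) Γ Δ▷φ Γ▷Δ = ▷-mp Γ (▷-subst Δ Γ Δ▷φ (λ δ∈ → Γ▷Δ (there δ∈))) (Γ▷Δ (here refl))

  ▷-mono : ∀ {Δ Γ φ} → Δ List.⊆ Γ → Δ ▷ φ → Γ ▷ φ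
  ▷-mono {Δ} {Γ} Δ⊆Γ Δ▷φ = ▷-subst Δ Γ Δ▷φ (λ δ∈ → ▷-hyp Γ (Δ⊆Γ δ∈))

  ⋀-intro : ∀ Γ φs → (∀ {φ} → φ ∈ φs → Γ ▷ φ) → Γ ▷ ⋀ φs
  ⋀-intro Γ []           _  = ▷-theorem Γ (⇒-refl ⊥')
  ⋀-intro Γ (φ ∷ [])     Γ▷ = Γ▷ (here refl)
  ⋀-intro Γ (φ ∷ ψ ∷ φs) Γ▷ = ▷-mp Γ (▷-mp Γ (▷-theorem Γ (ax-∧I _ _)) (Γ▷ (here refl)))
                                (⋀-intro Γ (ψ ∷ φs) (λ φ∈ → Γ▷ (there φ∈)))

  ⋀-elim : ∀ Γ φs {φ} → Γ ▷ ⋀ φs → φ ∈ φs → Γ ▷ φ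
  ⋀-elim Γ (φ ∷ [])     Γ▷ (here refl) = Γ▷
  ⋀-elim Γ (φ ∷ ψ ∷ φs) Γ▷ (here refl) = ▷-mp Γ (▷-theorem Γ (ax-∧E₁ _ _)) Γ▷
  ⋀-elim Γ (φ ∷ ψ ∷ φs) Γ▷ (there φ∈)  = ⋀-elim Γ (ψ ∷ φs) (▷-mp Γ (▷-theorem Γ (ax-∧E₂ _ _)) Γ▷) φ∈

  ⋁-intro : ∀ Γ φs {φ} → φ ∈ φs → Γ ▷ φ → Γ ▷ ⋁ φs
  ⋁-intro Γ (φ ∷ [])     (here refl) Γ▷ = Γ▷
  ⋁-intro Γ (φ ∷ ψ ∷ φs) (here refl) Γ▷ = ▷-mp Γ (▷-theorem Γ (ax-∨I₁ _ _)) Γ▷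
  ⋁-intro Γ (φ ∷ ψ ∷ φs) (there φ∈)  Γ▷ = ▷-mp Γ (▷-theorem Γ (ax-∨I₂ _ _)) (⋁-intro Γ (ψ ∷ φs) φ∈ Γ▷)

  ⋁-elim : ∀ Γ φs {χ} → (∀ {φ} → φ ∈ φs → Γ ▷ (φ ⇒ χ)) → Γ ▷ (⋁ φs ⇒ χ)
  ⋁-elim Γ []           _  = ▷-theorem Γ (ax-⊥E _)
  ⋁-elim Γ (φ ∷ [])     Γ▷ = Γ▷ (here refl)
  ⋁-elim Γ (φ ∷ ψ ∷ φs) Γ▷ = ▷-mp Γ (▷-mp Γ (▷-theorem Γ (ax-∨E _ _ _)) (Γ▷ (here refl)))
                               (⋁-elim Γ (ψ ∷ φs) (λ φ∈ → Γ▷ (there φ∈)))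

  ⋀⇒-to-▷ : ∀ Γ {φ} → Λ (⋀ Γ ⇒ φ) → Γ ▷ φ
  ⋀⇒-to-▷ Γ ⊢⋀Γ⇒φ = ▷-mp Γ (▷-theorem Γ ⊢⋀Γ⇒φ) (⋀-intro Γ Γ (▷-hyp Γ))

  ▷-to-⋀⇒ : ∀ Γ {φ} → Γ ▷ φ → Λ (⋀ Γ ⇒ φ)
  ▷-to-⋀⇒ Γ Γ▷φ = ▷-subst Γ (⋀ Γ ∷ []) Γ▷φ (⋀-elim (⋀ Γ ∷ []) Γ (▷-hyp (⋀ Γ ∷ []) (here refl)))

  _⊩_ : List (Form M) → List (Form M) → Set
  Γ ⊩ Δ = Γ ▷ ⋁ Δ

  ⊩-mono : ∀ {Γ Δ} Γ′ Δ′ → Γ List.⊆ Γ′ → Δ List.⊆ Δ′ → Γ ⊩ Δ → Γ′ ⊩ Δ′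
  ⊩-mono {Δ = Δ} Γ′ Δ′ Γ⊆ Δ⊆ Γ⊩Δ = ▷-mp Γ′ (▷-theorem Γ′ ⋁Δ⇒⋁Δ′) (▷-mono Γ⊆ Γ⊩Δ)
    where
      ⋁Δ⇒⋁Δ′ : Λ (⋁ Δ ⇒ ⋁ Δ′)
      ⋁Δ⇒⋁Δ′ = ⋁-elim [] Δ (λ {φ} φ∈ → ⋁-intro (φ ∷ []) Δ′ (Δ⊆ φ∈) (▷-hyp (φ ∷ []) (here refl)))

  ⊩-cut : ∀ Γ Δ χ → (χ ∷ Γ) ⊩ Δ → Γ ⊩ (χ ∷ Δ) → Γ ⊩ Δ
  ⊩-cut Γ Δ χ χ,Γ⊩Δ Γ⊩χ,Δ = ▷-mp Γ (⋁-elim Γ (χ ∷ Δ) case) Γ⊩χ,Δ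
    where
      case : ∀ {φ} → φ ∈ χ ∷ Δ → Γ ▷ (φ ⇒ ⋁ Δ)
      case (here refl) = χ,Γ⊩Δ
      case (there φ∈Δ) = ⋁-intro (_ ∷ Γ) Δ φ∈Δ (▷-hyp (_ ∷ Γ) (here refl))

module Sequents {M : Mods} {Λ : Pred (Form M) 0ℓ} (adm : IsAdmissible M Λ) where
  open HilbertCalculus adm

  infix 4 _⊢Λ_
  _⊢Λ_ : Pred (Form M) 0ℓ → Pred (Form M) 0ℓ → Set
  _⊢Λ_ = _⊢_ Λ

  ⊢-mono : ∀ {Γ Γ′ Δ Δ′} → Γ ⊆ Γ′ → Δ ⊆ Δ′ → Γ ⊢Λ Δ → Γ′ ⊢Λ Δ′
  ⊢-mono Γ⊆ Δ⊆ (Γs , Δs , Γs∈ , Δs∈ , ⊢Γs⇒Δs) = Γs , Δs , All-map Γ⊆ Γs∈ , All-map Δ⊆ Δs∈ , ⊢Γs⇒Δs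

  ⊢-cut : ∀ {Γ Δ} χ → Γ ∪ ｛ χ ｝ ⊢Λ Δ → Γ ⊢Λ Δ ∪ ｛ χ ｝ → Γ ⊢Λ Δ
  ⊢-cut χ (Γ₁ , Δ₁ , Γ₁∈ , Δ₁∈ , ⊢₁) (Γ₂ , Δ₂ , Γ₂∈ , Δ₂∈ , ⊢₂)
    with All-∪｛｝-split Γ₁∈ | All-∪｛｝-split Δ₂∈
  ... | Γ₁′ , Γ₁′∈ , Γ₁⊆ | Δ₂′ , Δ₂′∈ , Δ₂⊆ =
    Γs , Δs , ++⁺ Γ₁′∈ Γ₂∈ , ++⁺ Δ₁∈ Δ₂′∈ , ▷-to-⋀⇒ Γs (⊩-cut Γs Δs χ
      (⊩-mono (χ ∷ Γs) Δs (⊆ˡ-trans Γ₁⊆ (∷⁺ʳ χ (xs⊆xs++ys Γ₁′ Γ₂))) (xs⊆xs++ys Δ₁ Δ₂′) (⋀⇒-to-▷ Γ₁ ⊢₁))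
      (⊩-mono Γs (χ ∷ Δs) (xs⊆ys++xs Γ₂ Γ₁′) (⊆ˡ-trans Δ₂⊆ (∷⁺ʳ χ (xs⊆ys++xs Δ₂′ Δ₁))) (⋀⇒-to-▷ Γ₂ ⊢₂)))
    where
      Γs = Γ₁′ ++ Γ₂
      Δs = Δ₁ ++ Δ₂′

  ⊢-deduction : ∀ {Γ φ ψ} → Γ ∪ ｛ φ ｝ ⊢Λ ｛ ψ ｝ → Γ ⊢Λ ｛ φ ⇒ ψ ｝
  ⊢-deduction {φ = φ} {ψ} (Γs , Δs , Γs∈ , Δs∈ , ⊢Γs⇒Δs) with All-∪｛｝-split Γs∈
  ... | Γs′ , Γs′∈ , Γs⊆ = Γs′ , (φ ⇒ ψ) ∷ [] , Γs′∈ , refl ∷ [] ,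
    ▷-to-⋀⇒ Γs′ (⊩-mono (φ ∷ Γs′) (ψ ∷ []) Γs⊆ (λ δ∈ → here (sym (All-lookup Δs∈ δ∈))) (⋀⇒-to-▷ Γs ⊢Γs⇒Δs))

  pos-neg-disjoint : ∀ (Φ : PrimeType Λ) {φ} → pos Φ φ → neg Φ φ → ⊥
  pos-neg-disjoint Φ {φ} φ⁺ φ⁻ = unproves Φ (φ ∷ [] , φ ∷ [] , φ⁺ ∷ [] , φ⁻ ∷ [] , ⇒-refl φ)

  pos-⊆⇒≼c : ∀ (Φ Ψ : PrimeType Λ) → pos Φ ⊆ pos Ψ → _≼c_ Λ Φ Ψ
  pos-⊆⇒≼c Φ Ψ Φ⁺⊆Ψ⁺ = Φ⁺⊆Ψ⁺ , Ψ⁻⊆Φ⁻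
    where
      Ψ⁻⊆Φ⁻ : neg Ψ ⊆ neg Φ
      Ψ⁻⊆Φ⁻ {φ} φ∈Ψ⁻ with covers Φ φ
      ... | inj₁ φ∈Φ⁺ = ⊥-elim (pos-neg-disjoint Ψ (Φ⁺⊆Ψ⁺ φ∈Φ⁺) φ∈Ψ⁻)
      ... | inj₂ φ∈Φ⁻ = φ∈Φ⁻

module Lindenbaum {M : Mods} {Λ : Pred (Form M) 0ℓ} (adm : IsAdmissible M Λ)
                  (em : ExcludedMiddle 0ℓ) where
  open Enumeration M
  open Sequents adm

  Pair : Set₁
  Pair = Pred (Form M) 0ℓ × Pred (Form M) 0ℓ

  Unprovable : Pair → Set
  Unprovable (Γ , Δ) = ¬ (Γ ⊢Λ Δ)

  Decides : Pair → Form M → Set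
  Decides (Γ , Δ) χ = Γ χ ⊎ Δ χ

  _⊑_ : Pair → Pair → Set
  (Γ , Δ) ⊑ (Γ′ , Δ′) = (Γ ⊆ Γ′) × (Δ ⊆ Δ′)

  ⊑-refl : Reflexive _⊑_
  ⊑-refl = (λ x → x) , (λ x → x)

  ⊑-trans : Transitive _⊑_
  ⊑-trans (Γ⊆ , Δ⊆) (Γ⊆′ , Δ⊆′) = (λ x → Γ⊆′ (Γ⊆ x)) , (λ x → Δ⊆′ (Δ⊆ x))

  Decides-mono : ∀ {s t χ} → s ⊑ t → Decides s χ → Decides t χ
  Decides-mono (Γ⊆ , Δ⊆) = ⊎-map Γ⊆ Δ⊆

  -- If adding χ on the left makes the pair provable, cut shows that adding it
  -- on the right does not.
  extendBy : (s : Pair) (χ : Form M) → Dec (proj₁ s ∪ ｛ χ ｝ ⊢Λ proj₂ s) → Pair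
  extendBy (Γ , Δ) χ (yes _) = Γ , Δ ∪ ｛ χ ｝
  extendBy (Γ , Δ) χ (no _)  = Γ ∪ ｛ χ ｝ , Δ

  extend : Pair → Form M → Pair
  extend s χ = extendBy s χ em

  extendBy-⊒ : ∀ s χ d → s ⊑ extendBy s χ d
  extendBy-⊒ s χ (yes _) = (λ x → x) , inj₁
  extendBy-⊒ s χ (no _)  = inj₁ , (λ x → x)

  extendBy-decides : ∀ s χ d → Decides (extendBy s χ d) χ
  extendBy-decides s χ (yes _) = inj₂ (inj₂ refl)
  extendBy-decides s χ (no _)  = inj₁ (inj₂ refl)

  extendBy-unprovable : ∀ s χ d → Unprovable s → Unprovable (extendBy s χ d)
  extendBy-unprovable s χ (yes Γ,χ⊢Δ) Γ⊬Δ Γ⊢Δ,χ = Γ⊬Δ (⊢-cut χ Γ,χ⊢Δ Γ⊢Δ,χ)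
  extendBy-unprovable s χ (no Γ,χ⊬Δ)  Γ⊬Δ       = Γ,χ⊬Δ

  extendAll : List (Form M) → Pair → Pair
  extendAll []       s = s
  extendAll (χ ∷ χs) s = extendAll χs (extend s χ)

  extendAll-⊒ : ∀ χs s → s ⊑ extendAll χs s
  extendAll-⊒ []       s = ⊑-refl
  extendAll-⊒ (χ ∷ χs) s = ⊑-trans (extendBy-⊒ s χ em) (extendAll-⊒ χs (extend s χ))

  extendAll-decides : ∀ χs s {χ} → χ ∈ χs → Decides (extendAll χs s) χ
  extendAll-decides (χ ∷ χs) s (here refl) =
    Decides-mono (extendAll-⊒ χs (extend s χ)) (extendBy-decides s χ em)
  extendAll-decides (_ ∷ χs) s (there χ∈) = extendAll-decides χs _ χ∈

  extendAll-unprovable : ∀ χs s → Unprovable s → Unprovable (extendAll χs s)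
  extendAll-unprovable []       s s⊬ = s⊬
  extendAll-unprovable (χ ∷ χs) s s⊬ = extendAll-unprovable χs _ (extendBy-unprovable s χ em s⊬)

  module Limit (Γ Δ : Pred (Form M) 0ℓ) (Γ⊬Δ : ¬ (Γ ⊢Λ Δ)) where

    stage : ℕ → Pair
    stage zero    = Γ , Δ
    stage (suc n) = extendAll (formulas n) (stage n)

    stage-mono : ∀ {m n} → m ≤ n → stage m ⊑ stage n
    stage-mono = step-increasing⇒monotone _⊑_ ⊑-refl ⊑-trans stage (λ n → extendAll-⊒ (formulas n) (stage n))

    stage-unprovable : ∀ n → Unprovable (stage n)
    stage-unprovable zero    = Γ⊬Δ
    stage-unprovable (suc n) = extendAll-unprovable (formulas n) (stage n) (stage-unprovable n)

    Ψ⁺ Ψ⁻ : Pred (Form M) 0ℓ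
    Ψ⁺ φ = ∃ λ n → proj₁ (stage n) φ
    Ψ⁻ φ = ∃ λ n → proj₂ (stage n) φ

    Ψ-covers : ∀ φ → Ψ⁺ φ ⊎ Ψ⁻ φ
    Ψ-covers φ with formulas-complete φ
    ... | n , φ∈ = ⊎-map (suc n ,_) (suc n ,_) (extendAll-decides (formulas n) (stage n) φ∈)

    Ψ-unprovable : ¬ (Ψ⁺ ⊢Λ Ψ⁻)
    Ψ-unprovable (Γs , Δs , Γs∈ , Δs∈ , ⊢Γs⇒Δs)
      with All∃⇒∃All (λ m≤n → proj₁ (stage-mono m≤n)) Γs∈
         | All∃⇒∃All (λ m≤n → proj₂ (stage-mono m≤n)) Δs∈
    ... | m , Γs∈ₘ | n , Δs∈ₙ = stage-unprovable (m ⊔ n)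
      ( Γs , Δs
      , All-map (proj₁ (stage-mono (m≤m⊔n m n))) Γs∈ₘ
      , All-map (proj₂ (stage-mono (m≤n⊔m m n))) Δs∈ₙ
      , ⊢Γs⇒Δs )

    Ψ : PrimeType Λ
    Ψ = record { pos = Ψ⁺ ; neg = Ψ⁻ ; covers = Ψ-covers ; unproves = Ψ-unprovable }

  lindenbaum : ∀ {Γ Δ} → ¬ (Γ ⊢Λ Δ) → Σ (PrimeType Λ) λ Ψ → Γ ⊆ pos Ψ × Δ ⊆ neg Ψ
  lindenbaum {Γ} {Δ} Γ⊬Δ = Ψ , (zero ,_) , (zero ,_)
    where open Limit Γ Δ Γ⊬Δ

≼c-isPartialOrder : ∀ {M} (Λ : Pred (Form M) 0ℓ) → IsPartialOrder (_≈T_ Λ) (_≼c_ Λ)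
≼c-isPartialOrder Λ = On.isPartialOrder (λ Φ → pos Φ , neg Φ)
  (×-isPartialOrder ⊆-isPartialOrder (Flip.isPartialOrder ⊆-isPartialOrder))

neg-⇒-refuting-successor : ExcludedMiddle 0ℓ →
  ∀ {M} {Λ : Pred (Form M) 0ℓ} → IsAdmissible M Λ →
  ∀ (Φ : PrimeType Λ) φ ψ → neg Φ (φ ⇒ ψ) →
  Σ (PrimeType Λ) λ Ψ → _≼c_ Λ Φ Ψ × pos Ψ φ × neg Ψ ψ
neg-⇒-refuting-successor em adm Φ φ ψ φ⇒ψ∈Φ⁻ =
  let Ψ , Φ⁺,φ⊆Ψ⁺ , ψ⊆Ψ⁻ = lindenbaum Φ⁺,φ⊬ψ
  in Ψ , pos-⊆⇒≼c Φ Ψ (λ φ∈ → Φ⁺,φ⊆Ψ⁺ (inj₁ φ∈)) , Φ⁺,φ⊆Ψ⁺ (inj₂ refl) , ψ⊆Ψ⁻ refl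
  where
    open Sequents adm
    open Lindenbaum adm em

    Φ⁺,φ⊬ψ : ¬ (pos Φ ∪ ｛ φ ｝ ⊢Λ ｛ ψ ｝)
    Φ⁺,φ⊬ψ ⊢ψ = unproves Φ (⊢-mono (λ φ∈ → φ∈) (λ { refl → φ⇒ψ∈Φ⁻ }) (⊢-deduction ⊢ψ))

lemma5p4 : ExcludedMiddle 0ℓ →
    (M : Mods) (Λ : Pred (Form M) 0ℓ) → IsAdmissible M Λ →
    IsPartialOrder (_≈T_ Λ) (_≼c_ Λ)
    × (∀ (Φ : PrimeType Λ) (φ ψ : Form M) → neg Φ (φ ⇒ ψ) →
         Σ (PrimeType Λ) λ Ψ → _≼c_ Λ Φ Ψ × pos Ψ φ × neg Ψ ψ)
lemma5p4 em M Λ adm = ≼c-isPartialOrder Λ , neg-⇒-refuting-successor em adm
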